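{- Let $(\Pi,O,\mathcal{T})$ be a pseudo-PI-sequence. Then for any two policies $\pi\prec\pi'$ of $O$ and any well-defined $U\subseteq T^{\pi'}$, we have $\pi\neq\pi'\oplus U$.
   Context: Policies are vectors $\pi\in\{1,\dots,k\}^n$. A collection $U$ of state–action pairs is well-defined if each state appears at most once; then $\pi\oplus U$ is obtained from $\pi$ by setting the action at $s$ to $a$ for each $(s,a)\in U$. A pseudo-PI-sequence of size $m$ is a triple $(\Pi,O,\mathcal{T})$ where: $O$ is a finite sequence of distinct policies, totally ordered by position, with $\pi\prec\pi'$ meaning $\pi$ comes before $\pi'$ in $O$; $\mathcal{T}$ assigns to each policy $\pi$ in $O$ an abstract improvement set $T^\pi$, a set of pairs $(s,a)$ with $a\neq\pi(s)$, and $S^\pi$ denotes the set of states appearing in $T^\pi$; and $\Pi=\pi_0,\dots,\pi_{m-1}$ is a subsequence of $O$. It is required that: (i) for any two policies $\pi\prec\pi'$ in $O$ there is a state $s\in S^\pi$ with $\pi(s)\ne\pi'(s)$ and $(s,\pi(s))\notin T^{\pi'}$; (ii) for each $0\le i<m-1$, $O$ contains at least $|S^{\pi_i}|$ policies $\pi$ with $\pi_i\prec\pi\prec\pi_{i+1}$. -}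

module Defs where

open import Data.Nat using (ℕ; zero; suc; _<_; _≤_; _∸_)
open import Data.Bool using (Bool; true; false; if_then_else_; _∨_)
open import Data.Fin using (Fin; zero; suc; toℕ)
import Data.Fin as F
open import Data.Fin.Subset using (Subset; ∣_∣)
open import Data.Vec using (Vec; lookup; tabulate)
open import Data.List using (List; length)
import Data.List as L
open import Data.List.Relation.Unary.Unique.Propositional using (Unique)
open import Data.Maybe using (Maybe; just; nothing; maybe′)
import Data.Maybe as M
open import Data.Product using (Σ; ∃; _×_; _,_)
open import Function using (_∘_; id)
open import Relation.Binary.PropositionalEquality using (_≡_; _≢_)

Policy : ℕ → ℕ → Set
Policy n k = Vec (Fin k) n

PairSet : ℕ → ℕ → Set
PairSet n k = Fin n → Fin k → Bool

_∈ₚ_ : ∀ {n k} → Fin n × Fin k → PairSet n k → Set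
(s , a) ∈ₚ X = X s a ≡ true

_⊆ₚ_ : ∀ {n k} → PairSet n k → PairSet n k → Set
X ⊆ₚ Y = ∀ s a → (s , a) ∈ₚ X → (s , a) ∈ₚ Y

WellDefined : ∀ {n k} → PairSet n k → Set
WellDefined U = ∀ s a b → (s , a) ∈ₚ U → (s , b) ∈ₚ U → a ≡ b

firstTrue : ∀ {k} → (Fin k → Bool) → Maybe (Fin k)
firstTrue {zero} f = nothing
firstTrue {suc k} f = if f zero then just zero else M.map suc (firstTrue (f ∘ suc))

anyTrue : ∀ {k} → (Fin k → Bool) → Bool
anyTrue {zero} f = false
anyTrue {suc k} f = f zero ∨ anyTrue (f ∘ suc)

_⊕_ : ∀ {n k} → Policy n k → PairSet n k → Policy n k
π ⊕ U = tabulate (λ s → maybe′ id (lookup π s) (firstTrue (U s)))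

states : ∀ {n k} → PairSet n k → Subset n
states T = tabulate (λ s → anyTrue (T s))

_∈S_ : ∀ {n k} → Fin n → PairSet n k → Set
s ∈S T = ∃ λ a → (s , a) ∈ₚ T

IsImprovementSet : ∀ {n k} → Policy n k → PairSet n k → Set
IsImprovementSet π T = ∀ s a → (s , a) ∈ₚ T → a ≢ lookup π s

-- O is a list of distinct policies ordered by position (π ≺ π' iff index i < index j);
-- T assigns an improvement set to each policy of O (by its position);
-- Π is given by strictly increasing positions idx 0 < … < idx (m-1) in O.
record PseudoPISeq (n k m : ℕ) : Set where
  field
    O        : List (Policy n k)
    distinct : Unique O
    T        : Fin (length O) → PairSet n k
    T-impr   : ∀ i → IsImprovementSet (L.lookup O i) (T i)
    idx      : Fin m → Fin (length O)
    idx-mono : ∀ (i j : Fin m) → toℕ i < toℕ j → toℕ (idx i) < toℕ (idx j)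
    cond-i   : ∀ (i j : Fin (length O)) → toℕ i < toℕ j →
               ∃ λ s → s ∈S T i
                     × lookup (L.lookup O i) s ≢ lookup (L.lookup O j) s
                     × T j s (lookup (L.lookup O i) s) ≡ false
    cond-ii  : ∀ (i j : Fin m) → toℕ j ≡ suc (toℕ i) →
               ∣ states (T (idx i)) ∣ ≤ toℕ (idx j) ∸ suc (toℕ (idx i))

module Submission where

open import Defs
open import Data.Nat using (suc; _<_)
open import Data.Bool using (Bool; true; false)
open import Data.Fin using (Fin; toℕ; zero; suc)
open import Data.List using (length; lookup)
open import Data.Maybe using (just; nothing)
import Data.Maybe as Maybe
open import Data.Product using (_,_)
open import Data.Sum using (_⊎_; inj₁; inj₂)
import Data.Vec as Vec
open import Data.Vec.Properties using (lookup∘tabulate)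
open import Function using (_∘_)
open import Relation.Binary.PropositionalEquality
  using (_≡_; _≢_; refl; sym; trans)

firstTrue-sound : ∀ {k} (f : Fin k → Bool) {a : Fin k} → firstTrue f ≡ just a → f a ≡ true
firstTrue-sound {suc k} f eq with f zero in f0
firstTrue-sound {suc k} f refl | true = f0
... | false with firstTrue (f ∘ suc) in rest
firstTrue-sound {suc k} f refl | false | just b = firstTrue-sound (f ∘ suc) rest

lookup-⊕ : ∀ {n k} (π : Policy n k) (U : PairSet n k) (s : Fin n) →
           Vec.lookup (π ⊕ U) s ≡ Vec.lookup π s ⊎ (s , Vec.lookup (π ⊕ U) s) ∈ₚ U
lookup-⊕ π U s rewrite lookup∘tabulate (λ t → Maybe.maybe′ (λ a → a) (Vec.lookup π t) (firstTrue (U t))) s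
  with firstTrue (U s) in first
... | nothing = inj₁ refl
... | just a  = inj₂ (firstTrue-sound (U s) first)

≢-⊕-⊆ : ∀ {n k} (σ π : Policy n k) (U T : PairSet n k) (s : Fin n) →
        U ⊆ₚ T → Vec.lookup σ s ≢ Vec.lookup π s → T s (Vec.lookup σ s) ≡ false →
        σ ≢ π ⊕ U
≢-⊕-⊆ σ π U T s U⊆T σ[s]≢π[s] σ[s]∉T refl with lookup-⊕ π U s
... | inj₁ kept = σ[s]≢π[s] kept
... | inj₂ inU with trans (sym σ[s]∉T) (U⊆T s _ inU)
...   | ()

lemma2 : ∀ {n k m} (P : PseudoPISeq n k m) →
    let open PseudoPISeq P in
    ∀ (i j : Fin (length O)) → toℕ i < toℕ j →
    ∀ (U : PairSet n k) → WellDefined U → U ⊆ₚ T j →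
    lookup O i ≢ lookup O j ⊕ U
lemma2 P i j i<j U _ U⊆Tⱼ with PseudoPISeq.cond-i P i j i<j
... | s , _ , πᵢ[s]≢πⱼ[s] , πᵢ[s]∉Tⱼ =
  ≢-⊕-⊆ (lookup O i) (lookup O j) U (T j) s U⊆Tⱼ πᵢ[s]≢πⱼ[s] πᵢ[s]∉Tⱼ
  where open PseudoPISeq P
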